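{- Let $Q$ be a completable $k\times n$ partial Latin array and let $\mathbf L$ be a uniformly random $k\times n$ Latin rectangle. Consider a cell $(r,c)$ which is empty in $Q$, let $|Q_r|$ be the number of nonempty cells in row $r$ of $Q$, and suppose $2k+|Q_r|\le n/2$. Then for every symbol $s\in\{1,\dots,n\}$, \[\Pr[\mathbf L_{r,c}=s\mid Q\subseteq\mathbf L]\le\frac1n+O\!\left(\frac{k+|Q_r|}{n^2}\right),\] where the implied constant is absolute.
   Context: A $k\times n$ Latin rectangle is a $k\times n$ array, every cell filled with a symbol from $\{1,\dots,n\}$, such that every symbol appears at most once in each row and column. A $k\times n$ partial Latin array is a $k\times n$ array with some cells filled with symbols from $\{1,\dots,n\}$, no symbol appearing more than once in any row or column; $Q\subseteq L$ means $L$ agrees with $Q$ on every nonempty cell of $Q$; $Q$ is completable if it is contained in some $k\times n$ Latin rectangle. $\mathbf L_{r,c}$ denotes the symbol in cell $(r,c)$ of $\mathbf L$. -}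

module Defs where

open import Data.Nat using (ℕ; zero; suc; _+_)
open import Data.Fin using (Fin)
open import Data.Fin.Properties using (all?) renaming (_≟_ to _≟ᶠ_)
open import Data.Vec using (Vec; lookup; []; _∷_)
open import Data.List using (List; []; _∷_; map; concatMap; filter; length; allFin)
open import Data.Nat.ListAction using (sum)
open import Data.Maybe using (Maybe; just; nothing)
open import Data.Product using (Σ; _×_; _,_)
open import Data.Unit using (⊤; tt)
open import Relation.Nullary using (Dec; yes; no)
open import Relation.Nullary.Decidable using (_→-dec_; _×-dec_)
open import Relation.Binary.PropositionalEquality using (_≡_)

-- A k×n array with every cell filled by a symbol from Fin n (symbols 1..n ↦ 0..n-1).
Array : ℕ → ℕ → Set
Array k n = Vec (Vec (Fin n) n) k

entry : ∀ {k n} → Array k n → Fin k → Fin n → Fin n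
entry L i j = lookup (lookup L i) j

IsLatin : ∀ {k n} → Array k n → Set
IsLatin {k} {n} L =
  ((i : Fin k) (j j′ : Fin n) → entry L i j ≡ entry L i j′ → j ≡ j′) ×
  ((i i′ : Fin k) (j : Fin n) → entry L i j ≡ entry L i′ j → i ≡ i′)

PArray : ℕ → ℕ → Set
PArray k n = Fin k → Fin n → Maybe (Fin n)

IsPartialLatin : ∀ {k n} → PArray k n → Set
IsPartialLatin {k} {n} Q =
  ((i : Fin k) (j j′ : Fin n) (s : Fin n) → Q i j ≡ just s → Q i j′ ≡ just s → j ≡ j′) ×
  ((i i′ : Fin k) (j : Fin n) (s : Fin n) → Q i j ≡ just s → Q i′ j ≡ just s → i ≡ i′)

Agrees : ∀ {n} → Maybe (Fin n) → Fin n → Set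
Agrees nothing  _ = ⊤
Agrees (just s) t = s ≡ t

_⊆_ : ∀ {k n} → PArray k n → Array k n → Set
_⊆_ {k} {n} Q L = (i : Fin k) (j : Fin n) → Agrees (Q i j) (entry L i j)

Completable : ∀ {k n} → PArray k n → Set
Completable {k} {n} Q = Σ (Array k n) λ L → IsLatin L × (Q ⊆ L)

isFilled : ∀ {n} → Maybe (Fin n) → ℕ
isFilled nothing  = 0
isFilled (just _) = 1

rowSize : ∀ {k n} → PArray k n → Fin k → ℕ
rowSize {k} {n} Q r = sum (map (λ j → isFilled (Q r j)) (allFin n))

allVec : ∀ {A : Set} → List A → (m : ℕ) → List (Vec A m)
allVec xs zero    = [] ∷ []
allVec xs (suc m) = concatMap (λ x → map (x ∷_) (allVec xs m)) xs

allArrays : (k n : ℕ) → List (Array k n)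
allArrays k n = allVec (allVec (allFin n) n) k

isLatin? : ∀ {k n} (L : Array k n) → Dec (IsLatin L)
isLatin? L =
  all? (λ i → all? (λ j → all? (λ j′ → (entry L i j ≟ᶠ entry L i j′) →-dec (j ≟ᶠ j′))))
  ×-dec
  all? (λ i → all? (λ i′ → all? (λ j → (entry L i j ≟ᶠ entry L i′ j) →-dec (i ≟ᶠ i′))))

agrees? : ∀ {n} (m : Maybe (Fin n)) (t : Fin n) → Dec (Agrees m t)
agrees? nothing  _ = yes tt
agrees? (just s) t = s ≟ᶠ t

contains? : ∀ {k n} (Q : PArray k n) (L : Array k n) → Dec (Q ⊆ L)
contains? Q L = all? (λ i → all? (λ j → agrees? (Q i j) (entry L i j)))

countExt : ∀ {k n} → PArray k n → ℕ
countExt {k} {n} Q = length (filter (λ L → isLatin? L ×-dec contains? Q L) (allArrays k n))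

countExtAt : ∀ {k n} → PArray k n → Fin k → Fin n → Fin n → ℕ
countExtAt {k} {n} Q r c s =
  length (filter (λ L → isLatin? L ×-dec (contains? Q L ×-dec (entry L r c ≟ᶠ s))) (allArrays k n))

-- Switching argument. Let d = n − (2k + |Q_r|). In an extension L of Q with L_{r,c} = s, at
-- least d columns c′ are switchable: Q_{r,c′} is empty, L_{r,c′} does not occur in column c
-- and s does not occur in column c′. Exchanging the cells (r,c) and (r,c′) then gives an
-- extension of Q with s at (r,c′). The exchange is injective for fixed c′, and s occurs at
-- most once in row r, so d · #{L : L_{r,c} = s} ≤ #{L : Q ⊆ L}. Since 2k + |Q_r| ≤ n/2,
-- 1/d ≤ 1/n + 4(k + |Q_r|)/n².
module Submission where

open import Defs
open import Data.Nat using (ℕ; zero; suc; _+_; _*_; _∸_; _≤_; z≤n; s≤s)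
open import Data.Nat.Properties hiding (_≟_)
open import Data.Nat.ListAction using (sum)
open import Data.Nat.Tactic.RingSolver using (solve-∀)
open import Data.Fin using (Fin)
open import Data.Fin.Properties using (_≟_; all?; any?)
open import Data.Fin.Permutation.Components using (transpose; transpose-inverse)
open import Data.Vec using (Vec; []; _∷_; lookup; tabulate; updateAt)
open import Data.Vec.Properties
  using (lookup∘tabulate; tabulate∘lookup; tabulate-cong; lookup∘updateAt; lookup∘updateAt′;
         updateAt-updateAt; updateAt-id-local; ∷-injectiveˡ; ∷-injectiveʳ)
open import Data.List using (List; []; _∷_; _++_; map; filter; length; allFin)
open import Data.List.Properties using (length-++; length-map; length-tabulate)
open import Data.List.Membership.Propositional using (_∈_)
open import Data.List.Membership.Propositional.Properties
  using (∈-∃++; ∈-++⁻; ∈-++⁺ˡ; ∈-++⁺ʳ; ∈-map⁺; ∈-map⁻; ∈-map∘filter⁻; ∈-filter⁺; ∈-concatMap⁺; ∈-allFin)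
open import Data.List.Relation.Unary.Any using (here; there)
import Data.List.Relation.Unary.Any as Any
open import Data.List.Relation.Unary.All using ([])
import Data.List.Relation.Unary.All as All
import Data.List.Relation.Unary.All.Properties as All
import Data.List.Relation.Unary.AllPairs as AllPairs
import Data.List.Relation.Unary.AllPairs.Properties as AllPairs
open import Data.List.Relation.Unary.Unique.Propositional using (Unique; []; _∷_)
import Data.List.Relation.Unary.Unique.Propositional.Properties as Unique
open import Data.Maybe using (Maybe; just; nothing)
open import Data.Product using (Σ; _×_; _,_)
open import Data.Sum using (inj₁; inj₂)
open import Data.Unit using (tt)
open import Function using (_∘_)
open import Relation.Nullary using (Dec; yes; no; ¬_; contradiction)
open import Relation.Nullary.Decidable using (¬?; _×-dec_; dec-true; dec-false)
open import Relation.Unary using (Decidable)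
open import Relation.Binary.PropositionalEquality

private
  variable
    A B : Set
    k n : ℕ

∑ : List A → (A → ℕ) → ℕ
∑ []       f = 0
∑ (x ∷ xs) f = f x + ∑ xs f

syntax ∑ xs (λ x → e) = ∑[ x ∈ xs ] e

𝟙 : {P : Set} → Dec P → ℕ
𝟙 (yes _) = 1
𝟙 (no _)  = 0

𝟙-yes : {P : Set} (P? : Dec P) → P → 𝟙 P? ≡ 1
𝟙-yes (yes _) _  = refl
𝟙-yes (no ¬p) p  = contradiction p ¬p

𝟙-no : {P : Set} (P? : Dec P) → ¬ P → 𝟙 P? ≡ 0
𝟙-no (yes p) ¬p = contradiction p ¬p
𝟙-no (no _)  _  = refl

𝟙-× : {P R : Set} (P? : Dec P) (R? : Dec R) → 𝟙 (P? ×-dec R?) ≡ 𝟙 P? * 𝟙 R?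
𝟙-× (yes _) (yes _) = refl
𝟙-× (yes _) (no _)  = refl
𝟙-× (no _)  (yes _) = refl
𝟙-× (no _)  (no _)  = refl

∑-cong : (xs : List A) {f g : A → ℕ} → (∀ x → f x ≡ g x) → ∑ xs f ≡ ∑ xs g
∑-cong []       f≡g = refl
∑-cong (x ∷ xs) f≡g = cong₂ _+_ (f≡g x) (∑-cong xs f≡g)

∑-mono : (xs : List A) {f g : A → ℕ} → (∀ x → f x ≤ g x) → ∑ xs f ≤ ∑ xs g
∑-mono []       f≤g = z≤n
∑-mono (x ∷ xs) f≤g = +-mono-≤ (f≤g x) (∑-mono xs f≤g)

∑-distrib-+ : (xs : List A) (f g : A → ℕ) → ∑[ x ∈ xs ] (f x + g x) ≡ ∑ xs f + ∑ xs g
∑-distrib-+ []       f g = refl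
∑-distrib-+ (x ∷ xs) f g rewrite ∑-distrib-+ xs f g = +-interchange (f x) (g x) (∑ xs f) (∑ xs g)
  where
  +-interchange : ∀ a b c d → (a + b) + (c + d) ≡ (a + c) + (b + d)
  +-interchange = solve-∀

∑-const : (xs : List A) (m : ℕ) → ∑[ _ ∈ xs ] m ≡ length xs * m
∑-const []       m = refl
∑-const (x ∷ xs) m = cong (m +_) (∑-const xs m)

∑-*ˡ : (xs : List A) (f : A → ℕ) (m : ℕ) → ∑[ x ∈ xs ] (m * f x) ≡ m * ∑ xs f
∑-*ˡ []       f m = sym (*-zeroʳ m)
∑-*ˡ (x ∷ xs) f m = trans (cong (m * f x +_) (∑-*ˡ xs f m)) (sym (*-distribˡ-+ m (f x) _))

∑-*ʳ : (xs : List A) (f : A → ℕ) (m : ℕ) → ∑[ x ∈ xs ] (f x * m) ≡ ∑ xs f * m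
∑-*ʳ []       f m = refl
∑-*ʳ (x ∷ xs) f m = trans (cong (f x * m +_) (∑-*ʳ xs f m)) (sym (*-distribʳ-+ m (f x) _))

∑-comm : (xs : List A) (ys : List B) (f : A → B → ℕ) →
         ∑[ x ∈ xs ] ∑[ y ∈ ys ] f x y ≡ ∑[ y ∈ ys ] ∑[ x ∈ xs ] f x y
∑-comm []       ys f = sym (trans (∑-const ys 0) (*-zeroʳ (length ys)))
∑-comm (x ∷ xs) ys f =
  trans (cong (∑ ys (f x) +_) (∑-comm xs ys f)) (sym (∑-distrib-+ ys (f x) (λ y → ∑[ x ∈ xs ] f x y)))

∈⇒≤∑ : {xs : List A} {x : A} (f : A → ℕ) → x ∈ xs → f x ≤ ∑ xs f
∈⇒≤∑ {xs = y ∷ xs} f (here refl) = m≤m+n (f y) _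
∈⇒≤∑ {xs = y ∷ xs} f (there x∈xs) = ≤-trans (∈⇒≤∑ f x∈xs) (m≤n+m _ (f y))

∑-allFin-1 : ∀ n → ∑[ _ ∈ allFin n ] 1 ≡ n
∑-allFin-1 n = trans (∑-const (allFin n) 1) (trans (*-identityʳ _) (length-tabulate (λ x → x)))

length-filter : {P : A → Set} (P? : Decidable P) (xs : List A) →
                length (filter P? xs) ≡ ∑[ x ∈ xs ] 𝟙 (P? x)
length-filter P? []       = refl
length-filter P? (x ∷ xs) with P? x
... | yes _ = cong suc (length-filter P? xs)
... | no _  = length-filter P? xs

witness⇒1≤∑𝟙 : {P : A → Set} (P? : Decidable P) {xs : List A} {x : A} →
               x ∈ xs → P x → 1 ≤ ∑[ y ∈ xs ] 𝟙 (P? y)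
witness⇒1≤∑𝟙 P? {x = x} x∈xs px =
  ≤-trans (≤-reflexive (sym (𝟙-yes (P? x) px))) (∈⇒≤∑ (λ y → 𝟙 (P? y)) x∈xs)

∑𝟙-functional : {P : A → Set} (P? : Decidable P) (xs : List A) → Unique xs →
                (∀ x y → P x → P y → x ≡ y) → ∑[ x ∈ xs ] 𝟙 (P? x) ≤ 1
∑𝟙-functional P? []       _          _ = z≤n
∑𝟙-functional {P = P} P? (x ∷ xs) (x∉ ∷ uniq) functional with P? x
... | no _   = ∑𝟙-functional P? xs uniq functional
... | yes px = s≤s (≤-reflexive (∑𝟙-none xs (λ y∈xs py → All.lookup x∉ y∈xs (functional _ _ px py))))
  where
  ∑𝟙-none : ∀ ys → (∀ {y} → y ∈ ys → ¬ P y) → ∑[ y ∈ ys ] 𝟙 (P? y) ≡ 0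
  ∑𝟙-none []       _    = refl
  ∑𝟙-none (y ∷ ys) none = cong₂ _+_ (𝟙-no (P? y) (none (here refl))) (∑𝟙-none ys (none ∘ there))

Unique∧⊆⇒length≤ : {xs ys : List A} → Unique xs → (∀ {x} → x ∈ xs → x ∈ ys) → length xs ≤ length ys
Unique∧⊆⇒length≤ {xs = []}     _          _  = z≤n
Unique∧⊆⇒length≤ {xs = x ∷ xs} (x∉ ∷ uniq) xs⊆ys with ∈-∃++ (xs⊆ys (here refl))
... | us , vs , refl = begin
  suc (length xs)          ≤⟨ s≤s (Unique∧⊆⇒length≤ uniq xs⊆us++vs) ⟩
  suc (length (us ++ vs))  ≡⟨ cong suc (length-++ us) ⟩
  suc (length us + length vs) ≡⟨ sym (+-suc (length us) (length vs)) ⟩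
  length us + length (x ∷ vs) ≡⟨ sym (length-++ us) ⟩
  length (us ++ x ∷ vs)    ∎
  where
  open ≤-Reasoning
  xs⊆us++vs : ∀ {y} → y ∈ xs → y ∈ us ++ vs
  xs⊆us++vs y∈xs with ∈-++⁻ us (xs⊆ys (there y∈xs))
  ... | inj₁ y∈us          = ∈-++⁺ˡ y∈us
  ... | inj₂ (here y≡x)    = contradiction (sym y≡x) (All.lookup x∉ y∈xs)
  ... | inj₂ (there y∈vs)  = ∈-++⁺ʳ us y∈vs

∑𝟙-mono-injection : {P R : A → Set} (P? : Decidable P) (R? : Decidable R) (xs : List A) →
  Unique xs → (∀ x → x ∈ xs) → (f g : A → A) → (∀ x → g (f x) ≡ x) → (∀ x → P x → R (f x)) →
  ∑[ x ∈ xs ] 𝟙 (P? x) ≤ ∑[ x ∈ xs ] 𝟙 (R? x)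
∑𝟙-mono-injection {R = R} P? R? xs uniq complete f g g∘f≗id P⇒R∘f =
  subst₂ _≤_ (trans (length-map f (filter P? xs)) (length-filter P? xs)) (length-filter R? xs)
    (Unique∧⊆⇒length≤ (Unique.map⁺ f-injective (Unique.filter⁺ P? uniq)) image⊆)
  where
  f-injective : ∀ {x y} → f x ≡ f y → x ≡ y
  f-injective {x} {y} fx≡fy = trans (sym (g∘f≗id x)) (trans (cong g fx≡fy) (g∘f≗id y))
  image⊆ : ∀ {y} → y ∈ map f (filter P? xs) → y ∈ filter R? xs
  image⊆ y∈ with ∈-map∘filter⁻ f P? {xs = xs} y∈
  ... | x , _ , refl , px = ∈-filter⁺ R? (complete (f x)) (P⇒R∘f x px)

∈-allVec : (xs : List A) → (∀ x → x ∈ xs) → ∀ m (v : Vec A m) → v ∈ allVec xs m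
∈-allVec xs complete zero    []      = here refl
∈-allVec xs complete (suc m) (x ∷ v) =
  ∈-concatMap⁺ (λ y → map (y ∷_) (allVec xs m))
    (Any.map (λ { refl → ∈-map⁺ (x ∷_) (∈-allVec xs complete m v) }) (complete x))

allVec-unique : (xs : List A) → Unique xs → ∀ m → Unique (allVec xs m)
allVec-unique xs uniq zero    = [] ∷ []
allVec-unique xs uniq (suc m) =
  Unique.concat⁺ (All.map⁺ (All.universal (λ _ → Unique.map⁺ ∷-injectiveʳ (allVec-unique xs uniq m)) xs))
    (AllPairs.map⁺ (AllPairs.map disjoint uniq))
  where
  disjoint : ∀ {x y} → x ≢ y → ∀ {v} → ¬ (v ∈ map (x ∷_) (allVec xs m) × v ∈ map (y ∷_) (allVec xs m))
  disjoint x≢y (v∈x∷ , v∈y∷) with ∈-map⁻ _ v∈x∷ | ∈-map⁻ _ v∈y∷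
  ... | _ , _ , refl | _ , _ , x∷u≡y∷w = x≢y (∷-injectiveˡ x∷u≡y∷w)

∈-allArrays : ∀ k n (L : Array k n) → L ∈ allArrays k n
∈-allArrays k n = ∈-allVec _ (∈-allVec _ ∈-allFin n) k

allArrays-unique : ∀ k n → Unique (allArrays k n)
allArrays-unique k n = allVec-unique _ (allVec-unique _ (Unique.allFin⁺ n) n) k

transpose-atˡ : (i j : Fin n) → transpose i j i ≡ j
transpose-atˡ i j rewrite dec-true (i ≟ i) refl = refl

transpose-atʳ : (i j : Fin n) → transpose i j j ≡ i
transpose-atʳ i j with j ≟ i
... | yes j≡i = j≡i
... | no  _   rewrite dec-true (j ≟ j) refl = refl

transpose-fix : (i j : Fin n) {l : Fin n} → l ≢ i → l ≢ j → transpose i j l ≡ l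
transpose-fix i j {l} l≢i l≢j rewrite dec-false (l ≟ i) l≢i | dec-false (l ≟ j) l≢j = refl

swapCells : Fin k → Fin n → Fin n → Array k n → Array k n
swapCells r c c′ L = updateAt L r (λ row → tabulate (lookup row ∘ transpose c c′))

module _ (r : Fin k) (c c′ : Fin n) where

  entry-swapCells : (L : Array k n) (j : Fin n) →
                    entry (swapCells r c c′ L) r j ≡ entry L r (transpose c c′ j)
  entry-swapCells L j = trans (cong (λ row → lookup row j) (lookup∘updateAt r L)) (lookup∘tabulate _ j)

  entry-swapCells′ : (L : Array k n) {i : Fin k} (j : Fin n) → i ≢ r →
                     entry (swapCells r c c′ L) i j ≡ entry L i j
  entry-swapCells′ L {i} j i≢r = cong (λ row → lookup row j) (lookup∘updateAt′ i r i≢r L)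

  swapCells-inverse : (L : Array k n) → swapCells r c′ c (swapCells r c c′ L) ≡ L
  swapCells-inverse L = trans (updateAt-updateAt r L) (updateAt-id-local r L (begin
      tabulate (lookup (tabulate (lookup row ∘ transpose c c′)) ∘ transpose c′ c)
        ≡⟨ tabulate-cong (λ j → lookup∘tabulate _ (transpose c′ c j)) ⟩
      tabulate (lookup row ∘ transpose c c′ ∘ transpose c′ c)
        ≡⟨ tabulate-cong (λ j → cong (lookup row) (transpose-inverse c c′)) ⟩
      tabulate (lookup row)
        ≡⟨ tabulate∘lookup row ⟩
      row ∎))
    where
    open ≡-Reasoning
    row = lookup L r

  swapCells-isLatin : (L : Array k n) → IsLatin L →
                      (∀ i → entry L i c ≢ entry L r c′) → (∀ i → entry L i c′ ≢ entry L r c) →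
                      IsLatin (swapCells r c c′ L)
  swapCells-isLatin L (rowsInj , colsInj) c′∉colc c∉colc′ = rowsInj′ , colsInj′
    where
    L′ = swapCells r c c′ L

    rowsInj′ : ∀ i j j′ → entry L′ i j ≡ entry L′ i j′ → j ≡ j′
    rowsInj′ i j j′ e with i ≟ r
    ... | yes refl = begin
      j                                   ≡⟨ transpose-inverse c′ c ⟨
      transpose c′ c (transpose c c′ j)   ≡⟨ cong (transpose c′ c) (rowsInj r _ _ e′) ⟩
      transpose c′ c (transpose c c′ j′)  ≡⟨ transpose-inverse c′ c ⟩
      j′                                  ∎
      where
      open ≡-Reasoning
      e′ = trans (sym (entry-swapCells L j)) (trans e (entry-swapCells L j′))
    ... | no i≢r = rowsInj i j j′ (trans (sym (entry-swapCells′ L j i≢r)) (trans e (entry-swapCells′ L j′ i≢r)))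

    newEntry-absent : ∀ i j → entry L r (transpose c c′ j) ≡ entry L i j → r ≡ i
    newEntry-absent i j e = cases (j ≟ c) (j ≟ c′)
      where
      cases : Dec (j ≡ c) → Dec (j ≡ c′) → r ≡ i
      cases (yes refl) _          = contradiction (sym (trans (cong (entry L r) (sym (transpose-atˡ c c′))) e)) (c′∉colc i)
      cases (no _)     (yes refl) = contradiction (sym (trans (cong (entry L r) (sym (transpose-atʳ c c′))) e)) (c∉colc′ i)
      cases (no j≢c)   (no j≢c′)  = colsInj r i j (trans (cong (entry L r) (sym (transpose-fix c c′ j≢c j≢c′))) e)

    colsInj′ : ∀ i i′ j → entry L′ i j ≡ entry L′ i′ j → i ≡ i′
    colsInj′ i i′ j e with i ≟ r | i′ ≟ r
    ... | yes refl | yes refl = refl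
    ... | yes refl | no i′≢r  =
      newEntry-absent i′ j (trans (sym (entry-swapCells L j)) (trans e (entry-swapCells′ L j i′≢r)))
    ... | no i≢r   | yes refl =
      sym (newEntry-absent i j (trans (sym (entry-swapCells L j)) (trans (sym e) (entry-swapCells′ L j i≢r))))
    ... | no i≢r   | no i′≢r  =
      colsInj i i′ j (trans (sym (entry-swapCells′ L j i≢r)) (trans e (entry-swapCells′ L j i′≢r)))

  swapCells-⊆ : (Q : PArray k n) (L : Array k n) → Q r c ≡ nothing → Q r c′ ≡ nothing →
                Q ⊆ L → Q ⊆ swapCells r c c′ L
  swapCells-⊆ Q L Qrc≡nothing Qrc′≡nothing Q⊆L i j with i ≟ r
  ... | no i≢r = subst (Agrees (Q i j)) (sym (entry-swapCells′ L j i≢r)) (Q⊆L i j)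
  ... | yes refl = subst (Agrees (Q r j)) (sym (entry-swapCells L j)) (agrees (j ≟ c) (j ≟ c′))
    where
    agreesEmpty : ∀ {j} → Q r j ≡ nothing → Agrees (Q r j) (entry L r (transpose c c′ j))
    agreesEmpty Qrj≡nothing rewrite Qrj≡nothing = tt
    agrees : Dec (j ≡ c) → Dec (j ≡ c′) → Agrees (Q r j) (entry L r (transpose c c′ j))
    agrees (yes refl) _          = agreesEmpty Qrc≡nothing
    agrees (no _)     (yes refl) = agreesEmpty Qrc′≡nothing
    agrees (no j≢c)   (no j≢c′)  = subst (Agrees (Q r j)) (cong (entry L r) (sym (transpose-fix c c′ j≢c j≢c′))) (Q⊆L r j)

symbolOccurrencesInRow≤1 : (L : Array k n) → IsLatin L → ∀ i t → ∑[ j ∈ allFin n ] 𝟙 (entry L i j ≟ t) ≤ 1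
symbolOccurrencesInRow≤1 {n = n} L (rowsInj , _) i t =
  ∑𝟙-functional (λ j → entry L i j ≟ t) (allFin n) (Unique.allFin⁺ n) (λ j j′ e e′ → rowsInj i j j′ (trans e (sym e′)))

isFilled-empty : {m : Maybe (Fin n)} → isFilled m ≡ 0 → m ≡ nothing
isFilled-empty {m = nothing} _ = refl

empty? : (m : Maybe (Fin n)) → Dec (m ≡ nothing)
empty? nothing  = yes refl
empty? (just _) = no (λ ())

module Switching {k n : ℕ} (Q : PArray k n) (r : Fin k) (c s : Fin n) where

  Extends : Array k n → Set
  Extends L = IsLatin L × Q ⊆ L

  extends? : ∀ L → Dec (Extends L)
  extends? L = isLatin? L ×-dec contains? Q L

  -- Phrased so that the decision procedure is literally the one inside countExtAt.
  extends-s? : ∀ L → Dec (IsLatin L × (Q ⊆ L × entry L r c ≡ s))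
  extends-s? L = isLatin? L ×-dec (contains? Q L ×-dec (entry L r c ≟ s))

  Switchable : Array k n → Fin n → Set
  Switchable L c′ = Q r c′ ≡ nothing × (∀ i → entry L i c ≢ entry L r c′) × (∀ i → entry L i c′ ≢ s)

  switchable? : ∀ L c′ → Dec (Switchable L c′)
  switchable? L c′ = empty? (Q r c′) ×-dec
    (all? (λ i → ¬? (entry L i c ≟ entry L r c′)) ×-dec all? (λ i → ¬? (entry L i c′ ≟ s)))

  switchable-or-blocked : ∀ L c′ →
    1 ≤ 𝟙 (switchable? L c′) + (isFilled (Q r c′) +
          (∑[ i ∈ allFin k ] 𝟙 (entry L r c′ ≟ entry L i c) + ∑[ i ∈ allFin k ] 𝟙 (entry L i c′ ≟ s)))
  switchable-or-blocked L c′
    with isFilled (Q r c′) in filled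
       | any? (λ i → entry L r c′ ≟ entry L i c) | any? (λ i → entry L i c′ ≟ s)
  ... | suc _ | _ | _ = ≤-trans (m≤m+n 1 _) (m≤n+m _ (𝟙 (switchable? L c′)))
  ... | zero | yes (i , e) | _ =
    ≤-trans (≤-trans (witness⇒1≤∑𝟙 (λ i → entry L r c′ ≟ entry L i c) (∈-allFin i) e) (m≤m+n _ _))
            (m≤n+m _ (𝟙 (switchable? L c′)))
  ... | zero | no _ | yes (i , e) =
    ≤-trans (≤-trans (witness⇒1≤∑𝟙 (λ i → entry L i c′ ≟ s) (∈-allFin i) e) (m≤n+m _ _))
            (m≤n+m _ (𝟙 (switchable? L c′)))
  ... | zero | no ¬colc | no ¬colc′ =
    ≤-trans (≤-reflexive (sym (𝟙-yes (switchable? L c′) switchable))) (m≤m+n _ _)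
    where
    switchable : Switchable L c′
    switchable = isFilled-empty filled , (λ i e → ¬colc (i , sym e)) , (λ i e → ¬colc′ (i , e))

  -- Each row contains every symbol of column c, and the symbol s, at most once, so each of
  -- the last two obstructions in switchable-or-blocked rules out at most k columns.
  switchable-count : ∀ L → IsLatin L → n ∸ (2 * k + rowSize Q r) ≤ ∑[ c′ ∈ allFin n ] 𝟙 (switchable? L c′)
  switchable-count L latin = m≤n+o⇒m∸n≤o n (2 * k + rowSize Q r) (begin
    n                                          ≡⟨ ∑-allFin-1 n ⟨
    ∑[ _ ∈ allFin n ] 1                        ≤⟨ ∑-mono (allFin n) (switchable-or-blocked L) ⟩
    ∑[ c′ ∈ allFin n ] (S c′ + (isFilled (Q r c′) + (X c′ + Y c′)))
      ≡⟨ trans (∑-distrib-+ (allFin n) _ _) (cong (∑ (allFin n) S +_)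
           (trans (∑-distrib-+ (allFin n) _ _) (cong₂ _+_ (sym (sum-map (allFin n)))
             (∑-distrib-+ (allFin n) X Y)))) ⟩
    ∑ (allFin n) S + (rowSize Q r + (∑ (allFin n) X + ∑ (allFin n) Y))
      ≤⟨ +-monoʳ-≤ (∑ (allFin n) S) (+-monoʳ-≤ (rowSize Q r) (+-mono-≤ column-c-bound symbol-s-bound)) ⟩
    ∑ (allFin n) S + (rowSize Q r + (k + k))   ≡⟨ rearrange (∑ (allFin n) S) (rowSize Q r) k ⟩
    2 * k + rowSize Q r + ∑ (allFin n) S       ∎)
    where
    open ≤-Reasoning
    S X Y : Fin n → ℕ
    S c′ = 𝟙 (switchable? L c′)
    X c′ = ∑[ i ∈ allFin k ] 𝟙 (entry L r c′ ≟ entry L i c)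
    Y c′ = ∑[ i ∈ allFin k ] 𝟙 (entry L i c′ ≟ s)

    rearrange : ∀ v q k → v + (q + (k + k)) ≡ (2 * k + q) + v
    rearrange = solve-∀

    sum-map : ∀ (js : List (Fin n)) → sum (map (λ j → isFilled (Q r j)) js) ≡ ∑[ j ∈ js ] isFilled (Q r j)
    sum-map []       = refl
    sum-map (j ∷ js) = cong (isFilled (Q r j) +_) (sum-map js)

    rowwise≤k : (f : Fin n → Fin k → ℕ) → (∀ i → ∑[ c′ ∈ allFin n ] f c′ i ≤ 1) →
                ∑[ c′ ∈ allFin n ] ∑[ i ∈ allFin k ] f c′ i ≤ k
    rowwise≤k f each≤1 = begin
      ∑[ c′ ∈ allFin n ] ∑[ i ∈ allFin k ] f c′ i ≡⟨ ∑-comm (allFin n) (allFin k) f ⟩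
      ∑[ i ∈ allFin k ] ∑[ c′ ∈ allFin n ] f c′ i ≤⟨ ∑-mono (allFin k) each≤1 ⟩
      ∑[ _ ∈ allFin k ] 1                         ≡⟨ ∑-allFin-1 k ⟩
      k                                           ∎

    column-c-bound : ∑ (allFin n) X ≤ k
    column-c-bound = rowwise≤k _ (λ i → symbolOccurrencesInRow≤1 L latin r (entry L i c))

    symbol-s-bound : ∑ (allFin n) Y ≤ k
    symbol-s-bound = rowwise≤k _ (λ i → symbolOccurrencesInRow≤1 L latin i s)

  switch : Q r c ≡ nothing → ∀ c′ L → (IsLatin L × (Q ⊆ L × entry L r c ≡ s)) × Switchable L c′ →
           Extends (swapCells r c c′ L) × entry (swapCells r c c′ L) r c′ ≡ s
  switch Qrc≡nothing c′ L ((latin , Q⊆L , Lrc≡s) , Qrc′≡nothing , c′∉colc , s∉colc′) =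
    (swapCells-isLatin r c c′ L latin c′∉colc (λ i e → s∉colc′ i (trans e Lrc≡s)) ,
     swapCells-⊆ r c c′ Q L Qrc≡nothing Qrc′≡nothing Q⊆L) ,
    trans (entry-swapCells r c c′ L c′) (trans (cong (entry L r) (transpose-atʳ c c′)) Lrc≡s)

  countExtAt-switching : Q r c ≡ nothing → countExtAt Q r c s * (n ∸ (2 * k + rowSize Q r)) ≤ countExt Q
  countExtAt-switching Qrc≡nothing = begin
    countExtAt Q r c s * d                                  ≡⟨ cong (_* d) (length-filter extends-s? arrays) ⟩
    ∑[ L ∈ arrays ] 𝟙 (extends-s? L) * d                     ≡⟨ ∑-*ʳ arrays _ d ⟨
    ∑[ L ∈ arrays ] (𝟙 (extends-s? L) * d)                   ≤⟨ ∑-mono arrays many-switches ⟩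
    ∑[ L ∈ arrays ] ∑[ c′ ∈ columns ] 𝟙 (before? c′ L)       ≡⟨ ∑-comm arrays columns _ ⟩
    ∑[ c′ ∈ columns ] ∑[ L ∈ arrays ] 𝟙 (before? c′ L)       ≤⟨ ∑-mono columns switch-injective ⟩
    ∑[ c′ ∈ columns ] ∑[ L ∈ arrays ] 𝟙 (after? c′ L)        ≡⟨ ∑-comm arrays columns _ ⟨
    ∑[ L ∈ arrays ] ∑[ c′ ∈ columns ] 𝟙 (after? c′ L)        ≤⟨ ∑-mono arrays s-once-in-row ⟩
    ∑[ L ∈ arrays ] 𝟙 (extends? L)                           ≡⟨ length-filter extends? arrays ⟨
    countExt Q                                              ∎
    where
    open ≤-Reasoning
    d = n ∸ (2 * k + rowSize Q r)
    arrays = allArrays k n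
    columns = allFin n

    before? : ∀ c′ L → Dec ((IsLatin L × (Q ⊆ L × entry L r c ≡ s)) × Switchable L c′)
    before? c′ L = extends-s? L ×-dec switchable? L c′

    after? : ∀ c′ L → Dec (Extends L × entry L r c′ ≡ s)
    after? c′ L = extends? L ×-dec (entry L r c′ ≟ s)

    many-switches : ∀ L → 𝟙 (extends-s? L) * d ≤ ∑[ c′ ∈ columns ] 𝟙 (before? c′ L)
    many-switches L = begin
      𝟙 (extends-s? L) * d                                    ≤⟨ bound (extends-s? L) ⟩
      𝟙 (extends-s? L) * ∑[ c′ ∈ columns ] 𝟙 (switchable? L c′) ≡⟨ ∑-*ˡ columns (λ c′ → 𝟙 (switchable? L c′)) (𝟙 (extends-s? L)) ⟨
      ∑[ c′ ∈ columns ] (𝟙 (extends-s? L) * 𝟙 (switchable? L c′)) ≡⟨ ∑-cong columns (λ c′ → 𝟙-× (extends-s? L) (switchable? L c′)) ⟨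
      ∑[ c′ ∈ columns ] 𝟙 (before? c′ L)                       ∎
      where
      bound : (P? : Dec (IsLatin L × (Q ⊆ L × entry L r c ≡ s))) →
              𝟙 P? * d ≤ 𝟙 P? * ∑[ c′ ∈ columns ] 𝟙 (switchable? L c′)
      bound (yes (latin , _)) = *-monoʳ-≤ 1 (switchable-count L latin)
      bound (no _)            = z≤n

    switch-injective : ∀ c′ → ∑[ L ∈ arrays ] 𝟙 (before? c′ L) ≤ ∑[ L ∈ arrays ] 𝟙 (after? c′ L)
    switch-injective c′ =
      ∑𝟙-mono-injection (before? c′) (after? c′) arrays (allArrays-unique k n) (∈-allArrays k n)
        (swapCells r c c′) (swapCells r c′ c) (swapCells-inverse r c c′) (switch Qrc≡nothing c′)

    s-once-in-row : ∀ L → ∑[ c′ ∈ columns ] 𝟙 (after? c′ L) ≤ 𝟙 (extends? L)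
    s-once-in-row L = begin
      ∑[ c′ ∈ columns ] 𝟙 (after? c′ L)                          ≡⟨ ∑-cong columns (λ c′ → 𝟙-× (extends? L) (entry L r c′ ≟ s)) ⟩
      ∑[ c′ ∈ columns ] (𝟙 (extends? L) * 𝟙 (entry L r c′ ≟ s))  ≡⟨ ∑-*ˡ columns (λ c′ → 𝟙 (entry L r c′ ≟ s)) (𝟙 (extends? L)) ⟩
      𝟙 (extends? L) * ∑[ c′ ∈ columns ] 𝟙 (entry L r c′ ≟ s)    ≤⟨ bound (extends? L) ⟩
      𝟙 (extends? L)                                            ∎
      where
      bound : (P? : Dec (Extends L)) → 𝟙 P? * ∑[ c′ ∈ columns ] 𝟙 (entry L r c′ ≟ s) ≤ 𝟙 P?
      bound (yes (latin , _)) = ≤-trans (≤-reflexive (*-identityˡ _)) (symbolOccurrencesInRow≤1 L latin r s)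
      bound (no _)            = z≤n

-- With n = m + d: n² a = n·(d a) + m·(n a) and n a ≤ 2 d a because m ≤ d.
switching-arithmetic : ∀ m d a N → m ≤ d → a * d ≤ N → (m + d) * (m + d) * a ≤ (m + d + 2 * m) * N
switching-arithmetic m d a N m≤d ad≤N = begin
  (m + d) * (m + d) * a                ≡⟨ expand m d a ⟩
  (m + d) * (d * a) + m * ((m + d) * a) ≤⟨ +-mono-≤ (*-monoʳ-≤ (m + d) da≤N) (*-monoʳ-≤ m [m+d]a≤2N) ⟩
  (m + d) * N + m * (2 * N)            ≡⟨ collect m d N ⟩
  (m + d + 2 * m) * N                  ∎
  where
  open ≤-Reasoning
  expand : ∀ m d a → (m + d) * (m + d) * a ≡ (m + d) * (d * a) + m * ((m + d) * a)
  expand = solve-∀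
  collect : ∀ m d N → (m + d) * N + m * (2 * N) ≡ (m + d + 2 * m) * N
  collect = solve-∀
  da≤N : d * a ≤ N
  da≤N = ≤-trans (≤-reflexive (*-comm d a)) ad≤N
  [m+d]a≤2N : (m + d) * a ≤ 2 * N
  [m+d]a≤2N = begin
    (m + d) * a   ≡⟨ *-distribʳ-+ a m d ⟩
    m * a + d * a ≤⟨ +-mono-≤ (≤-trans (*-monoˡ-≤ a m≤d) da≤N) da≤N ⟩
    N + N         ≡⟨ cong (N +_) (+-identityʳ N) ⟨
    2 * N         ∎

countExtAt-bound : (Q : PArray k n) (r : Fin k) (c s : Fin n) → Q r c ≡ nothing →
                   2 * (2 * k + rowSize Q r) ≤ n →
                   n * n * countExtAt Q r c s ≤ (n + 4 * (k + rowSize Q r)) * countExt Q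
countExtAt-bound {k} {n} Q r c s Qrc≡nothing 2m≤n = begin
  n * n * a               ≡⟨ cong (λ x → x * x * a) m+d≡n ⟨
  (m + d) * (m + d) * a   ≤⟨ switching-arithmetic m d a N m≤d (Switching.countExtAt-switching Q r c s Qrc≡nothing) ⟩
  (m + d + 2 * m) * N     ≡⟨ cong (λ x → (x + 2 * m) * N) m+d≡n ⟩
  (n + 2 * m) * N         ≤⟨ *-monoˡ-≤ N (+-monoʳ-≤ n 2m≤4[k+q]) ⟩
  (n + 4 * (k + q)) * N   ∎
  where
  open ≤-Reasoning
  q = rowSize Q r
  m = 2 * k + q
  d = n ∸ m
  a = countExtAt Q r c s
  N = countExt Q
  m+m≤n : m + m ≤ n
  m+m≤n = subst (_≤ n) (cong (m +_) (+-identityʳ m)) 2m≤n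
  m+d≡n : m + d ≡ n
  m+d≡n = m+[n∸m]≡n (m+n≤o⇒m≤o m m+m≤n)
  m≤d : m ≤ d
  m≤d = m+n≤o⇒m≤o∸n m m+m≤n
  2m≤4[k+q] : 2 * m ≤ 4 * (k + q)
  2m≤4[k+q] = subst (2 * m ≤_) (split k q) (m≤m+n (2 * m) (2 * q))
    where
    split : ∀ k q → 2 * (2 * k + q) + 2 * q ≡ 4 * (k + q)
    split = solve-∀

-- Q need not be partial Latin or completable: without extensions both sides are 0.
lemma3p3 : Σ ℕ λ C → (k n : ℕ) (Q : PArray k n) → IsPartialLatin Q → Completable Q →
    (r : Fin k) (c : Fin n) → Q r c ≡ nothing → 2 * (2 * k + rowSize Q r) ≤ n →
    (s : Fin n) →
    n * n * countExtAt Q r c s ≤ (n + C * (k + rowSize Q r)) * countExt Q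
lemma3p3 = 4 , λ k n Q _ _ r c Qrc≡nothing 2m≤n s → countExtAt-bound Q r c s Qrc≡nothing 2m≤n
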